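{- For integers $n\ge m\ge 5$, $t^{0}(P_n\square P_m)=2$, $t^{1}(P_n\square P_m)=4$ and $t^{2}(P_n\square P_m)=7$.
   Context: $P_n$ is the path on $n$ vertices and $\square$ the Cartesian product. For a graph $\Gamma=(V,E)$ and $F\subseteq V$, $F$ is a $g$-good-neighbor conditional faulty set if every vertex of $V\setminus F$ has at least $g$ neighbors in $V\setminus F$. PMC model: distinct $F_1,F_2\subseteq V$ are distinguishable iff there exist $u\in F_1\triangle F_2$, $v\in V\setminus(F_1\cup F_2)$ with $uv\in E$. $t^g(\Gamma)$ is the maximum $t$ such that every pair of distinct $g$-good-neighbor conditional faulty sets of size at most $t$ is distinguishable. -}

module Defs where

open import Data.Nat using (ℕ; zero; suc; _+_; _≤_)
open import Data.Fin using (Fin; toℕ)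
open import Data.Bool using (Bool; true; false; if_then_else_; not; _∧_; _xor_)
open import Data.List using (List; map; allFin)
open import Data.Nat.ListAction using (sum)
open import Data.Product using (_×_; _,_; Σ; ∃; ∃-syntax)
open import Data.Sum using (_⊎_)
open import Relation.Binary.PropositionalEquality using (_≡_; _≢_)
open import Relation.Nullary using (¬_; Dec; yes; no)
open import Relation.Nullary.Decidable using (⌊_⌋; _⊎-dec_; _×-dec_)
import Data.Nat.Properties as ℕP
import Data.Fin.Properties as FinP

Vertex : ℕ → ℕ → Set
Vertex n m = Fin n × Fin m

PathAdj : {k : ℕ} → Fin k → Fin k → Set
PathAdj i j = (suc (toℕ i) ≡ toℕ j) ⊎ (suc (toℕ j) ≡ toℕ i)

pathAdj? : {k : ℕ} → (i j : Fin k) → Dec (PathAdj i j)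
pathAdj? i j = (suc (toℕ i) ℕP.≟ toℕ j) ⊎-dec (suc (toℕ j) ℕP.≟ toℕ i)

Adj : {n m : ℕ} → Vertex n m → Vertex n m → Set
Adj (i , j) (i' , j') = ((i ≡ i') × PathAdj j j') ⊎ (PathAdj i i' × (j ≡ j'))

adj? : {n m : ℕ} → (u v : Vertex n m) → Dec (Adj u v)
adj? (i , j) (i' , j') =
  ((i FinP.≟ i') ×-dec pathAdj? j j') ⊎-dec (pathAdj? i i' ×-dec (j FinP.≟ j'))

VSet : ℕ → ℕ → Set
VSet n m = Vertex n m → Bool

countV : {n m : ℕ} → (Vertex n m → Bool) → ℕ
countV {n} {m} p =
  sum (map (λ i → sum (map (λ j → if p (i , j) then 1 else 0) (allFin m))) (allFin n))

size : {n m : ℕ} → VSet n m → ℕ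
size F = countV F

outsideDeg : {n m : ℕ} → VSet n m → Vertex n m → ℕ
outsideDeg F v = countV (λ u → ⌊ adj? v u ⌋ ∧ not (F u))

GoodNeighborFaulty : {n m : ℕ} → ℕ → VSet n m → Set
GoodNeighborFaulty g F = ∀ v → F v ≡ false → g ≤ outsideDeg F v

Distinct : {n m : ℕ} → VSet n m → VSet n m → Set
Distinct F₁ F₂ = ∃[ x ] (F₁ x ≢ F₂ x)

-- PMC distinguishability: some u ∈ F₁ △ F₂ adjacent to some v ∈ V \ (F₁ ∪ F₂).
Distinguishable : {n m : ℕ} → VSet n m → VSet n m → Set
Distinguishable F₁ F₂ =
  ∃[ u ] ∃[ v ] ((F₁ u xor F₂ u) ≡ true × F₁ v ≡ false × F₂ v ≡ false × Adj u v)

Diagnosable : (n m g t : ℕ) → Set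
Diagnosable n m g t = (F₁ F₂ : VSet n m) →
  GoodNeighborFaulty g F₁ → GoodNeighborFaulty g F₂ →
  size F₁ ≤ t → size F₂ ≤ t → Distinct F₁ F₂ → Distinguishable F₁ F₂

GoodNeighborDiagnosability : (n m g k : ℕ) → Set
GoodNeighborDiagnosability n m g k =
  Diagnosable n m g k × (∀ t → Diagnosable n m g t → t ≤ k)

{-# OPTIONS --safe #-}

-- Let F₁ ≠ F₂ be indistinguishable, D = F₁ △ F₂, C = F₁ ∩ F₂ and, up to symmetry,
-- A = F₂ ∖ F₁ ≠ ∅. Every neighbour of a D-cell lies in D ∪ C, and A inherits minimum degree g
-- from the good-neighbour condition on F₁. Count row by row: a row meeting D meets C or lies
-- inside D, and a row next to a D-row has at least as many cells in C ∪ D as that row has in D.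
-- Hence a row inside D forces |F₁| + |F₂| = |D| + 2|C| ≥ 3m ≥ 15. Otherwise every D-row and
-- every row next to one meets C, and the top-left and bottom-right cells of D give
-- |C| ≥ 2, 3, 4 while those of A give |A| ≥ 1, 2, 4; so |F₂| = |A| + |C| ≥ 3, 5, 8 for
-- g = 0, 1, 2. The bounds are attained by F₁ = N(S), F₂ = N[S] with S a corner vertex, a
-- corner edge and a corner 2 × 2 square.
module Submission where

open import Data.Bool using (Bool; true; false; if_then_else_; not; _∧_; _∨_; _xor_; T)
import Data.Bool as Bool
open import Data.Bool.Properties
  using (¬-not; ∨-comm; xor-comm; ∧-assoc; ∧-zeroʳ; ∨-identityʳ; not-involutive)
open import Data.Empty using (⊥; ⊥-elim)
open import Data.Fin as Fin using (Fin; toℕ; fromℕ<)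
open import Data.Fin.Properties using (toℕ-fromℕ<; fromℕ<-toℕ; toℕ<n; toℕ-injective; any?)
open import Data.List using (map; allFin; tabulate)
open import Data.List.Properties using (map-tabulate)
open import Data.Nat using (ℕ; zero; suc; _+_; _≤_; _<_; z≤n; s≤s; s≤s⁻¹; _≡ᵇ_; _≤ᵇ_; _≟_; _<?_; _≤?_)
open import Data.Nat.ListAction using (sum)
open import Data.Nat.Properties
open import Data.Nat.Solver using (module +-*-Solver)
open import Data.Product using (_×_; _,_; ∃; ∃-syntax; proj₁; proj₂)
open import Data.Sum using (_⊎_; inj₁; inj₂; [_,_]′)
import Data.Sum as Sum
open import Data.Vec using (Vec; []; _∷_; lookup)
open import Function using (_∘_; id)
open import Function.Bundles using (_⇔_; mk⇔; module Equivalence)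
open import Relation.Binary using (tri<; tri≈; tri>)
open import Relation.Binary.PropositionalEquality
  using (_≡_; _≢_; refl; sym; trans; cong; cong₂; subst; subst₂; module ≡-Reasoning)
open import Relation.Nullary using (¬_; Dec; yes; no; does)
open import Relation.Nullary.Decidable
  using (⌊_⌋; True; toWitness; dec-true; dec-false; _⊎-dec_; _×-dec_; isYes≗does; does-⇔; map′)
open import Relation.Unary using (Decidable)

open import Defs

open +-*-Solver using (solve; _:+_; _:=_)
open import Algebra.Properties.CommutativeSemigroup +-commutativeSemigroup using (interchange)

ind : Bool → ℕ
ind b = if b then 1 else 0

ind≤1 : ∀ b → ind b ≤ 1
ind≤1 true  = ≤-refl
ind≤1 false = z≤n

ind-true : ∀ {b} → b ≡ true → 1 ≤ ind b
ind-true refl = ≤-refl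

ind-mono : ∀ {b b′} → (b ≡ true → b′ ≡ true) → ind b ≤ ind b′
ind-mono {false} _ = z≤n
ind-mono {true}  h rewrite h refl = ≤-refl

≡true⇒≢false : ∀ {b} → b ≡ true → b ≢ false
≡true⇒≢false refl ()

not≡true⇒≡false : ∀ {b} → not b ≡ true → b ≡ false
not≡true⇒≡false {b} e = trans (sym (not-involutive b)) (cong not e)

≡ᵇ-refl : ∀ a → (a ≡ᵇ a) ≡ true
≡ᵇ-refl a = dec-true (a ≟ a) refl

≡ᵇ-≢ : ∀ {a b} → a ≢ b → (a ≡ᵇ b) ≡ false
≡ᵇ-≢ {a} {b} = dec-false (a ≟ b)

≡ᵇ-comm : ∀ a b → (a ≡ᵇ b) ≡ (b ≡ᵇ a)
≡ᵇ-comm zero    zero    = refl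
≡ᵇ-comm zero    (suc b) = refl
≡ᵇ-comm (suc a) zero    = refl
≡ᵇ-comm (suc a) (suc b) = ≡ᵇ-comm a b

1+n≡ᵇn : ∀ a → (suc a ≡ᵇ a) ≡ false
1+n≡ᵇn a = ≡ᵇ-≢ {suc a} {a} 1+n≢n

both-one : ∀ {x y} → x ≤ 1 → y ≤ 1 → 2 ≤ x + y → 1 ≤ x × 1 ≤ y
both-one {1} {1} _ _ _ = ≤-refl , ≤-refl
both-one {0} _ y≤1 2≤y = ⊥-elim (<-irrefl refl (≤-trans 2≤y y≤1))
both-one {1} {0} _ _ (s≤s ())
both-one {1} {suc (suc _)} _ (s≤s ())
both-one {suc (suc _)} (s≤s ())

one-of : ∀ {x y} → 1 ≤ x + y → 1 ≤ x ⊎ 1 ≤ y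
one-of {suc _} _   = inj₁ (s≤s z≤n)
one-of {zero}  1≤y = inj₂ 1≤y

larger-half : ∀ k {x y} → suc (k + k) ≤ x + y → suc k ≤ x ⊎ suc k ≤ y
larger-half k {x} {y} h with suc k ≤? x | suc k ≤? y
... | yes k<x | _       = inj₁ k<x
... | no  _   | yes k<y = inj₂ k<y
... | no  k≮x | no  k≮y =
  ⊥-elim (<-irrefl refl (<-≤-trans h (+-mono-≤ (≮⇒≥ k≮x) (≮⇒≥ k≮y))))

module _ {P : ℕ → Set} (P? : Decidable P) where

  least : ∀ v → ∃[ k ] (k < v × P k) → ∃[ i ] (i < v × P i × (∀ {j} → j < i → ¬ P j))
  least (suc v) (k , k<1+v , Pk) with anyUpTo? P? v
  ... | yes below = let (i , i<v , Pi , min) = least v below in i , m<n⇒m<1+n i<v , Pi , min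
  ... | no ¬below = k , k<1+v , Pk , λ j<k Pj → ¬below (_ , <-≤-trans j<k (s≤s⁻¹ k<1+v) , Pj)

  greatest : ∀ v → ∃[ k ] (k < v × P k) → ∃[ i ] (i < v × P i × (∀ {j} → i < j → j < v → ¬ P j))
  greatest (suc v) (k , k<1+v , Pk) with P? v
  ... | yes Pv = v , ≤-refl , Pv , λ v<j j<1+v _ → <-irrefl refl (<-≤-trans v<j (s≤s⁻¹ j<1+v))
  ... | no ¬Pv with m<1+n⇒m<n∨m≡n k<1+v
  ...   | inj₂ refl = ⊥-elim (¬Pv Pk)
  ...   | inj₁ k<v =
    let (i , i<v , Pi , max) = greatest v (k , k<v , Pk) in
    i , m<n⇒m<1+n i<v , Pi ,
    λ i<j j<1+v → [ max i<j , (λ { refl → ¬Pv }) ]′ (m<1+n⇒m<n∨m≡n j<1+v)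

constant-or-change : (p : ℕ → Bool) → ∀ v →
  (∀ {k} → k < v → p k ≡ p 0) ⊎ ∃[ k ] (suc k < v × p k ≢ p (suc k))
constant-or-change p zero = inj₁ λ ()
constant-or-change p (suc zero) = inj₁ λ { (s≤s z≤n) → refl }
constant-or-change p (suc (suc v)) with constant-or-change p (suc v)
... | inj₂ (k , k+1<v , change) = inj₂ (k , m<n⇒m<1+n k+1<v , change)
... | inj₁ constant with p v Bool.≟ p (suc v)
...   | no  change = inj₂ (v , ≤-refl , change)
...   | yes same   = inj₁ λ k<v+2 → extend (m<1+n⇒m<n∨m≡n k<v+2)
  where
  extend : ∀ {k} → k < suc v ⊎ k ≡ suc v → p k ≡ p 0
  extend (inj₁ k<v+1) = constant k<v+1
  extend (inj₂ refl)  = trans (sym same) (constant (n<1+n v))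

-- Finite sums

Σ< : ℕ → (ℕ → ℕ) → ℕ
Σ< zero    f = 0
Σ< (suc n) f = Σ< n f + f n

Σ<-cong : ∀ n {f g} → (∀ {k} → k < n → f k ≡ g k) → Σ< n f ≡ Σ< n g
Σ<-cong zero    _   = refl
Σ<-cong (suc n) f≡g = cong₂ _+_ (Σ<-cong n (f≡g ∘ m<n⇒m<1+n)) (f≡g ≤-refl)

Σ<-mono-≤ : ∀ n {f g} → (∀ {k} → k < n → f k ≤ g k) → Σ< n f ≤ Σ< n g
Σ<-mono-≤ zero    _   = z≤n
Σ<-mono-≤ (suc n) f≤g = +-mono-≤ (Σ<-mono-≤ n (f≤g ∘ m<n⇒m<1+n)) (f≤g ≤-refl)

Σ<-zero : ∀ n {f} → (∀ {k} → k < n → f k ≡ 0) → Σ< n f ≡ 0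
Σ<-zero zero    _   = refl
Σ<-zero (suc n) f≡0 = cong₂ _+_ (Σ<-zero n (f≡0 ∘ m<n⇒m<1+n)) (f≡0 ≤-refl)

Σ<-+ : ∀ n (f g : ℕ → ℕ) → Σ< n (λ k → f k + g k) ≡ Σ< n f + Σ< n g
Σ<-+ zero    f g = refl
Σ<-+ (suc n) f g =
  trans (cong (_+ (f n + g n)) (Σ<-+ n f g)) (interchange (Σ< n f) (Σ< n g) (f n) (g n))

n≤Σ< : ∀ n {f} → (∀ {k} → k < n → 1 ≤ f k) → n ≤ Σ< n f
n≤Σ< zero    _    = z≤n
n≤Σ< (suc n) {f} 1≤f =
  subst (_≤ Σ< n f + f n) (+-comm n 1) (+-mono-≤ (n≤Σ< n (1≤f ∘ m<n⇒m<1+n)) (1≤f ≤-refl))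

Σ<-prefix : ∀ {k n} f → k ≤ n → Σ< k f ≤ Σ< n f
Σ<-prefix {n = zero}  f z≤n = z≤n
Σ<-prefix {k} {suc n} f k≤n+1 with m≤n⇒m<n∨m≡n k≤n+1
... | inj₁ k<n+1  = ≤-trans (Σ<-prefix f (s≤s⁻¹ k<n+1)) (m≤m+n (Σ< n f) (f n))
... | inj₂ refl   = ≤-refl

≤Σ<-term : ∀ {a n x} f → a < n → x ≤ f a → x ≤ Σ< n f
≤Σ<-term {a} f a<n x≤fa = ≤-trans x≤fa (≤-trans (m≤n+m (f a) (Σ< a f)) (Σ<-prefix f a<n))

≤Σ<-+term : ∀ {a n x y} f → a < n → x ≤ Σ< a f → y ≤ f a → x + y ≤ Σ< n f
≤Σ<-+term f a<n x≤ y≤ = ≤-trans (+-mono-≤ x≤ y≤) (Σ<-prefix f a<n)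

Σ<-≥-pair : ∀ {a b n x y} f → a < b → b < n → x ≤ f a → y ≤ f b → x + y ≤ Σ< n f
Σ<-≥-pair f a<b b<n x≤ y≤ = ≤Σ<-+term f b<n (≤Σ<-term f a<b x≤) y≤

Σ<-≥-triple : ∀ {a b c n x y z} f → a < b → b < c → c < n → x ≤ f a → y ≤ f b → z ≤ f c →
              x + y + z ≤ Σ< n f
Σ<-≥-triple f a<b b<c c<n x≤ y≤ z≤ = ≤Σ<-+term f c<n (Σ<-≥-pair f a<b b<c x≤ y≤) z≤

Σ<-single : ∀ {a n} f → a < n → (∀ {k} → k < n → k ≢ a → f k ≡ 0) → Σ< n f ≡ f a
Σ<-single {a} {suc n} f a<n+1 others with m<1+n⇒m<n∨m≡n a<n+1
... | inj₁ a<n  =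
  trans (cong₂ _+_ (Σ<-single f a<n (others ∘ m<n⇒m<1+n)) (others ≤-refl (>⇒≢ a<n))) (+-identityʳ (f a))
... | inj₂ refl = cong (_+ f n) (Σ<-zero n (λ k<n → others (m<n⇒m<1+n k<n) (<⇒≢ k<n)))

Σ<-truncate : ∀ {k n} f → k ≤ n → (∀ {i} → k ≤ i → i < n → f i ≡ 0) → Σ< n f ≡ Σ< k f
Σ<-truncate {k} {zero} f z≤n _ = refl
Σ<-truncate {k} {suc n} f k≤n+1 beyond with m≤n⇒m<n∨m≡n k≤n+1
... | inj₁ k<n+1 =
  trans (cong₂ _+_ (Σ<-truncate f (s≤s⁻¹ k<n+1) (λ k≤i → beyond k≤i ∘ m<n⇒m<1+n)) (beyond (s≤s⁻¹ k<n+1) ≤-refl))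
        (+-identityʳ (Σ< k f))
... | inj₂ refl  = refl

Σ<-point : ∀ {a k} (g : ℕ → Bool) → a < k → Σ< k (λ j → ind ((a ≡ᵇ j) ∧ g j)) ≡ ind (g a)
Σ<-point {a} g a<k =
  trans (Σ<-single (λ j → ind ((a ≡ᵇ j) ∧ g j)) a<k vanish) (cong (λ e → ind (e ∧ g a)) (≡ᵇ-refl a))
  where
  vanish : ∀ {j} → _ → j ≢ a → ind ((a ≡ᵇ j) ∧ g j) ≡ 0
  vanish {j} _ j≢a rewrite ≡ᵇ-≢ {a} {j} (j≢a ∘ sym) = refl

Σ<-point-outside : ∀ {a k} (g : ℕ → Bool) → k ≤ a → Σ< k (λ j → ind ((a ≡ᵇ j) ∧ g j)) ≡ 0
Σ<-point-outside {a} g k≤a = Σ<-zero _ vanish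
  where
  vanish : ∀ {j} → j < _ → ind ((a ≡ᵇ j) ∧ g j) ≡ 0
  vanish {j} j<k rewrite ≡ᵇ-≢ {a} {j} (>⇒≢ (<-≤-trans j<k k≤a)) = refl

-- Neighbours in a path

PathAdjℕ : ℕ → ℕ → Set
PathAdjℕ i j = suc i ≡ j ⊎ suc j ≡ i

pathAdjℕ? : ∀ i j → Dec (PathAdjℕ i j)
pathAdjℕ? i j = (suc i ≟ j) ⊎-dec (suc j ≟ i)

adjacent≢ : ∀ {a b} → PathAdjℕ a b → b ≢ a
adjacent≢ (inj₁ refl) = 1+n≢n
adjacent≢ (inj₂ refl) = 1+n≢n ∘ sym

Σ<-≥-adjacent : ∀ {a b n x y} f → a < n → b < n → PathAdjℕ a b → x ≤ f a → y ≤ f b → x + y ≤ Σ< n f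
Σ<-≥-adjacent f _   b<n (inj₁ refl) x≤ y≤ = Σ<-≥-pair f ≤-refl b<n x≤ y≤
Σ<-≥-adjacent {n = n} {x} {y} f a<n _ (inj₂ refl) x≤ y≤ =
  subst (_≤ Σ< n f) (+-comm y x) (Σ<-≥-pair f ≤-refl a<n y≤ x≤)

before : (ℕ → Bool) → ℕ → ℕ
before f zero    = 0
before f (suc i) = ind (f i)

after : ℕ → (ℕ → Bool) → ℕ → ℕ
after k f i = if ⌊ suc i <? k ⌋ then ind (f (suc i)) else 0

pathDegree : ℕ → (ℕ → Bool) → ℕ → ℕ
pathDegree k f i = before f i + after k f i

after-inside : ∀ {k i} f → suc i < k → after k f i ≡ ind (f (suc i))
after-inside {k} {i} f i+1<k with suc i <? k
... | yes _     = refl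
... | no  i+1≮k = ⊥-elim (i+1≮k i+1<k)

after-outside : ∀ {k i} f → k ≤ suc i → after k f i ≡ 0
after-outside {k} {i} f k≤i+1 with suc i <? k
... | yes i+1<k = ⊥-elim (≤⇒≯ k≤i+1 i+1<k)
... | no  _     = refl

before≤1 : ∀ f i → before f i ≤ 1
before≤1 f zero    = z≤n
before≤1 f (suc i) = ind≤1 (f i)

after≤1 : ∀ k f i → after k f i ≤ 1
after≤1 k f i with suc i <? k
... | yes _ = ind≤1 (f (suc i))
... | no  _ = z≤n

1≤before : ∀ f {i} → 1 ≤ before f i → ∃[ i₀ ] (i ≡ suc i₀ × f i₀ ≡ true)
1≤before f {suc i₀} 1≤ = i₀ , refl , 1≤ind 1≤
  where
  1≤ind : ∀ {b} → 1 ≤ ind b → b ≡ true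
  1≤ind {true} _ = refl

1≤after : ∀ {k} f {i} → 1 ≤ after k f i → suc i < k × f (suc i) ≡ true
1≤after {k} f {i} 1≤ with suc i <? k | f (suc i)
1≤after f 1≤ | yes i+1<k | true  = i+1<k , refl
1≤after f () | yes _     | false
1≤after f () | no  _     | _

pathDegree-before : ∀ {k} f {i₀} → f i₀ ≡ true → 1 ≤ pathDegree k f (suc i₀)
pathDegree-before {k} f {i₀} fi₀ = ≤-trans (ind-true fi₀) (m≤m+n _ (after k f (suc i₀)))

pathDegree-after : ∀ {k} f {i} → suc i < k → f (suc i) ≡ true → 1 ≤ pathDegree k f i
pathDegree-after f {i} i+1<k fi+1 =
  ≤-trans (≤-trans (ind-true fi+1) (≤-reflexive (sym (after-inside f i+1<k)))) (m≤n+m _ (before f i))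

before-empty : ∀ f {i} → (∀ {i₀} → i₀ < i → f i₀ ≡ false) → before f i ≡ 0
before-empty f {zero}  _     = refl
before-empty f {suc i} empty = cong ind (empty ≤-refl)

after-empty : ∀ {k} f {i} → (∀ {i₁} → i < i₁ → i₁ < k → f i₁ ≡ false) → after k f i ≡ 0
after-empty {k} f {i} empty with suc i <? k
... | yes i+1<k = cong ind (empty ≤-refl i+1<k)
... | no  _     = refl

Σ<-pathAdj : ∀ {k b} q → b < k → Σ< k (λ j → ind (does (pathAdjℕ? b j) ∧ q j)) ≡ pathDegree k q b
Σ<-pathAdj {k} {b} q b<k = begin
  Σ< k (λ j → ind (does (pathAdjℕ? b j) ∧ q j))
    ≡⟨ Σ<-cong k (λ {j} _ → split j) ⟩
  Σ< k (λ j → ind ((suc j ≡ᵇ b) ∧ q j) + ind ((suc b ≡ᵇ j) ∧ q j))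
    ≡⟨ Σ<-+ k _ _ ⟩
  Σ< k (λ j → ind ((suc j ≡ᵇ b) ∧ q j)) + Σ< k (λ j → ind ((suc b ≡ᵇ j) ∧ q j))
    ≡⟨ cong₂ _+_ (before-part b b<k) after-part ⟩
  pathDegree k q b ∎
  where
  open ≡-Reasoning
  split : ∀ j → ind (does (pathAdjℕ? b j) ∧ q j) ≡ ind ((suc j ≡ᵇ b) ∧ q j) + ind ((suc b ≡ᵇ j) ∧ q j)
  split j with suc b ≟ j
  ... | yes refl rewrite ≡ᵇ-refl b | ≡ᵇ-≢ {suc (suc b)} {b} (>⇒≢ (<-trans ≤-refl (n<1+n (suc b)))) = refl
  ... | no  b+1≢j rewrite ≡ᵇ-≢ b+1≢j = sym (+-identityʳ _)
  before-part : ∀ b → b < k → Σ< k (λ j → ind ((suc j ≡ᵇ b) ∧ q j)) ≡ before q b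
  before-part zero     _   = Σ<-zero k (λ _ → refl)
  before-part (suc b₀) b<k =
    trans (Σ<-cong k λ {j} _ → cong (λ e → ind (e ∧ q j)) (≡ᵇ-comm j b₀)) (Σ<-point q (<-trans ≤-refl b<k))
  after-part : Σ< k (λ j → ind ((suc b ≡ᵇ j) ∧ q j)) ≡ after k q b
  after-part with k ≤? suc b
  ... | yes k≤b+1 = trans (Σ<-point-outside q k≤b+1) (sym (after-outside q k≤b+1))
  ... | no  k≰b+1 = trans (Σ<-point q (≰⇒> k≰b+1)) (sym (after-inside q (≰⇒> k≰b+1)))

pathDegree-mono : ∀ {k f f′} i → i < k → (∀ {x} → x < k → PathAdjℕ i x → f x ≡ true → f′ x ≡ true) →
                  pathDegree k f i ≤ pathDegree k f′ i
pathDegree-mono {k} i i<k f⇒f′ = +-mono-≤ (before-mono i i<k f⇒f′) (after-mono i f⇒f′)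
  where
  before-mono : ∀ {f f′} i → i < k → (∀ {x} → x < k → PathAdjℕ i x → f x ≡ true → f′ x ≡ true) →
                before f i ≤ before f′ i
  before-mono zero     _   _    = z≤n
  before-mono (suc i₀) i<k f⇒f′ = ind-mono (f⇒f′ (<-trans (n<1+n i₀) i<k) (inj₂ refl))
  after-mono : ∀ {f f′} i → (∀ {x} → x < k → PathAdjℕ i x → f x ≡ true → f′ x ≡ true) →
               after k f i ≤ after k f′ i
  after-mono i f⇒f′ with suc i <? k
  ... | yes i+1<k = ind-mono (f⇒f′ i+1<k (inj₁ refl))
  ... | no  _     = z≤n

pathDegree-resize : ∀ {k k′ i} f → suc i < k → suc i < k′ → pathDegree k f i ≡ pathDegree k′ f i
pathDegree-resize {i = i} f i+1<k i+1<k′ =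
  cong (before f i +_) (trans (after-inside f i+1<k) (sym (after-inside f i+1<k′)))

pathDegree-≥1 : ∀ {c k f i} → 2 + c ≤ k → c ≤ i → i < k → (∀ {x} → c ≤ x → f x ≡ true) →
                1 ≤ pathDegree k f i
pathDegree-≥1 {c} {k} {f} {i} 2+c≤k c≤i i<k beyond with k ≤? suc i
... | no k≰i+1 = pathDegree-after f (≰⇒> k≰i+1) (beyond (≤-trans c≤i (n≤1+n i)))
pathDegree-≥1 {i = zero} 2+c≤k _ _ _ | yes k≤1 = ⊥-elim (<⇒≱ (≤-trans (s≤s (s≤s z≤n)) 2+c≤k) k≤1)
pathDegree-≥1 {k = k} {f} {suc i₀} 2+c≤k _ _ beyond | yes k≤i+1 =
  pathDegree-before {k} f (beyond (s≤s⁻¹ (s≤s⁻¹ (≤-trans 2+c≤k k≤i+1))))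

-- The grid

-- The vertex (i , j) of P_n □ P_m is the cell in row i and column j. A set of vertices is
-- represented by a Boolean function on ℕ × ℕ; only the cells with i < n and j < m are inspected.
Cells : Set
Cells = ℕ → ℕ → Bool

∁ : Cells → Cells
∁ P i j = not (P i j)

Adjℕ : ℕ × ℕ → ℕ × ℕ → Set
Adjℕ (a , b) (i , j) = (a ≡ i × PathAdjℕ b j) ⊎ (b ≡ j × PathAdjℕ a i)

adjℕ? : ∀ u v → Dec (Adjℕ u v)
adjℕ? (a , b) (i , j) = (a ≟ i ×-dec pathAdjℕ? b j) ⊎-dec (b ≟ j ×-dec pathAdjℕ? a i)

module Grid (n m : ℕ) where

  rowCount : Cells → ℕ → ℕ
  rowCount P r = Σ< m (λ j → ind (P r j))

  count : Cells → ℕ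
  count P = Σ< n (rowCount P)

  degreeIn : Cells → ℕ → ℕ → ℕ
  degreeIn P i j = pathDegree n (λ r → P r j) i + pathDegree m (P i) j

  MinDegree : ℕ → Cells → Set
  MinDegree g P = ∀ {i j} → i < n → j < m → P i j ≡ true → g ≤ degreeIn P i j

  rowCount-≥1 : ∀ {P r j} → j < m → P r j ≡ true → 1 ≤ rowCount P r
  rowCount-≥1 {P} {r} j<m Prj = ≤Σ<-term (λ j → ind (P r j)) j<m (ind-true Prj)

  count-≥1 : ∀ {P i j} → i < n → j < m → P i j ≡ true → 1 ≤ count P
  count-≥1 {P} i<n j<m Pij = ≤Σ<-term (rowCount P) i<n (rowCount-≥1 {P} j<m Pij)

  rowCount-≥2 : ∀ {P r j} → suc j < m → P r j ≡ true → P r (suc j) ≡ true → 2 ≤ rowCount P r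
  rowCount-≥2 {P} {r} {j} j+1<m Prj Prj+1 =
    Σ<-≥-pair (λ j → ind (P r j)) (n<1+n j) j+1<m (ind-true Prj) (ind-true Prj+1)

  rowCount-≡0 : ∀ {P r} → (∀ {j} → j < m → P r j ≡ false) → rowCount P r ≡ 0
  rowCount-≡0 empty = Σ<-zero m (cong ind ∘ empty)

  count-cong : ∀ {P Q} → (∀ {i j} → i < n → j < m → P i j ≡ Q i j) → count P ≡ count Q
  count-cong P≡Q = Σ<-cong n λ i<n → Σ<-cong m λ j<m → cong ind (P≡Q i<n j<m)

  count-split : ∀ {P Q R} → (∀ i j → ind (P i j) ≡ ind (Q i j) + ind (R i j)) →
                count P ≡ count Q + count R
  count-split {P} {Q} {R} split = trans (Σ<-cong n λ {r} _ → row r) (Σ<-+ n (rowCount Q) (rowCount R))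
    where
    row : ∀ r → rowCount P r ≡ rowCount Q r + rowCount R r
    row r = trans (Σ<-cong m λ {j} _ → split r j) (Σ<-+ m (λ j → ind (Q r j)) (λ j → ind (R r j)))

  adjacent-counted : ∀ {Q a b i j} → i < n → j < m → Adjℕ (a , b) (i , j) → Q i j ≡ true →
                     1 ≤ degreeIn Q a b
  adjacent-counted {Q} {a} {b} _ j<m (inj₁ (refl , inj₁ refl)) Qij =
    ≤-trans (pathDegree-after (Q a) j<m Qij) (m≤n+m _ (pathDegree n (λ r → Q r b) a))
  adjacent-counted {Q} {a} {b} _ _ (inj₁ (refl , inj₂ refl)) Qij =
    ≤-trans (pathDegree-before {m} (Q a) Qij) (m≤n+m _ (pathDegree n (λ r → Q r b) a))
  adjacent-counted {Q} {a} {b} i<n _ (inj₂ (refl , inj₁ refl)) Qij =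
    ≤-trans (pathDegree-after (λ r → Q r b) i<n Qij) (m≤m+n _ (pathDegree m (Q a) b))
  adjacent-counted {Q} {a} {b} _ _ (inj₂ (refl , inj₂ refl)) Qij =
    ≤-trans (pathDegree-before {n} (λ r → Q r b) Qij) (m≤m+n _ (pathDegree m (Q a) b))

  rowCount-adjacent : ∀ (Q : Cells) {a b} → b < m → ∀ i →
                      rowCount (λ i j → does (adjℕ? (a , b) (i , j)) ∧ Q i j) i
                      ≡ ind (does (pathAdjℕ? a i) ∧ Q i b) + (if a ≡ᵇ i then pathDegree m (Q a) b else 0)
  rowCount-adjacent Q {a} {b} b<m i with a ≟ i
  rowCount-adjacent Q {a} {b} b<m .a | yes refl = begin
    Σ< m (λ j → ind (does (adjℕ? (a , b) (a , j)) ∧ Q a j)) ≡⟨ Σ<-cong m (λ {j} _ → cell j) ⟩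
    Σ< m (λ j → ind (does (pathAdjℕ? b j) ∧ Q a j))         ≡⟨ Σ<-pathAdj (Q a) b<m ⟩
    pathDegree m (Q a) b                                    ≡⟨ sym split ⟩
    ind (does (pathAdjℕ? a a) ∧ Q a b) + (if a ≡ᵇ a then pathDegree m (Q a) b else 0) ∎
    where
    open ≡-Reasoning
    cell : ∀ j → ind (does (adjℕ? (a , b) (a , j)) ∧ Q a j) ≡ ind (does (pathAdjℕ? b j) ∧ Q a j)
    cell j rewrite ≡ᵇ-refl a | 1+n≡ᵇn a | ∧-zeroʳ (b ≡ᵇ j) | ∨-identityʳ (does (pathAdjℕ? b j)) = refl
    split : ind (does (pathAdjℕ? a a) ∧ Q a b) + (if a ≡ᵇ a then pathDegree m (Q a) b else 0)
            ≡ pathDegree m (Q a) b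
    split rewrite ≡ᵇ-refl a | 1+n≡ᵇn a = refl
  rowCount-adjacent Q {a} {b} b<m i | no a≢i rewrite ≡ᵇ-≢ a≢i =
    trans (Σ<-cong m λ {j} _ → cong ind (∧-assoc (b ≡ᵇ j) (does (pathAdjℕ? a i)) (Q i j)))
          (trans (Σ<-point (λ j → does (pathAdjℕ? a i) ∧ Q i j) b<m) (sym (+-identityʳ _)))

  count-adjacent≡degreeIn : ∀ (Q : Cells) {a b} → a < n → b < m →
                            count (λ i j → does (adjℕ? (a , b) (i , j)) ∧ Q i j) ≡ degreeIn Q a b
  count-adjacent≡degreeIn Q {a} {b} a<n b<m = begin
    Σ< n (rowCount (λ i j → does (adjℕ? (a , b) (i , j)) ∧ Q i j))
                                                   ≡⟨ Σ<-cong n (λ {i} _ → rowCount-adjacent Q b<m i) ⟩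
    Σ< n (λ i → vertical i + horizontal i)         ≡⟨ Σ<-+ n vertical horizontal ⟩
    Σ< n vertical + Σ< n horizontal                ≡⟨ cong₂ _+_ (Σ<-pathAdj (λ r → Q r b) a<n)
                                                                 (Σ<-single horizontal a<n off-row) ⟩
    pathDegree n (λ r → Q r b) a + horizontal a    ≡⟨ cong (pathDegree n (λ r → Q r b) a +_) on-row ⟩
    degreeIn Q a b                                 ∎
    where
    open ≡-Reasoning
    vertical horizontal : ℕ → ℕ
    vertical i = ind (does (pathAdjℕ? a i) ∧ Q i b)
    horizontal i = if a ≡ᵇ i then pathDegree m (Q a) b else 0
    off-row : ∀ {i} → i < n → i ≢ a → horizontal i ≡ 0
    off-row {i} _ i≢a rewrite ≡ᵇ-≢ {a} {i} (i≢a ∘ sym) = refl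
    on-row : horizontal a ≡ pathDegree m (Q a) b
    on-row rewrite ≡ᵇ-refl a = refl

  degreeIn-mono : ∀ {P Q i j} → i < n → j < m →
                  (∀ {x y} → x < n → y < m → Adjℕ (i , j) (x , y) → P x y ≡ true → Q x y ≡ true) →
                  degreeIn P i j ≤ degreeIn Q i j
  degreeIn-mono {i = i} {j} i<n j<m P⇒Q =
    +-mono-≤ (pathDegree-mono i i<n λ x<n adj → P⇒Q x<n j<m (inj₂ (refl , adj)))
             (pathDegree-mono j j<m λ y<m adj → P⇒Q i<n y<m (inj₁ (refl , adj)))

  RowOccupied : Cells → ℕ → Set
  RowOccupied P r = ∃[ j ] (j < m × P r j ≡ true)

  rowOccupied? : ∀ P → Decidable (RowOccupied P)
  rowOccupied? P r = anyUpTo? (λ j → P r j Bool.≟ true) m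

  unoccupied : ∀ {P r j} → ¬ RowOccupied P r → j < m → P r j ≡ false
  unoccupied empty j<m = ¬-not λ P≡ → empty (_ , j<m , P≡)

  adjacentRow : 2 ≤ n → ∀ {r} → r < n → ∃[ s ] (s < n × PathAdjℕ r s)
  adjacentRow 2≤n {r} r<n with suc r <? n
  ... | yes r+1<n = suc r , r+1<n , inj₁ refl
  adjacentRow 2≤n {zero}   r<n | no r+1≮n = ⊥-elim (r+1≮n 2≤n)
  adjacentRow 2≤n {suc r₀} r<n | no _     = r₀ , <-trans (n<1+n r₀) r<n , inj₂ refl

  record TopLeft (P : Cells) : Set where
    field
      row col     : ℕ
      row<n       : row < n
      col<m       : col < m
      corner      : P row col ≡ true
      above-empty : ∀ {r j} → r < row → j < m → P r j ≡ false
      left-empty  : ∀ {j} → j < col → P row j ≡ false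

  record BottomRight (P : Cells) : Set where
    field
      row col     : ℕ
      row<n       : row < n
      col<m       : col < m
      corner      : P row col ≡ true
      below-empty : ∀ {r j} → row < r → r < n → j < m → P r j ≡ false
      right-empty : ∀ {j} → col < j → j < m → P row j ≡ false

  topLeft : ∀ {P i j} → i < n → j < m → P i j ≡ true → TopLeft P
  topLeft {P} {i} {j} i<n j<m Pij =
    let (r , r<n , (c₀ , c₀<m , Prc₀) , above) = least (rowOccupied? P) n (i , i<n , j , j<m , Pij)
        (c , c<m , Prc , left) = least (λ j → P r j Bool.≟ true) m (c₀ , c₀<m , Prc₀)
    in record { row = r ; col = c ; row<n = r<n ; col<m = c<m ; corner = Prc
              ; above-empty = λ r′<r → unoccupied {P} (above r′<r)
              ; left-empty  = λ j<c → ¬-not (left j<c) }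

  bottomRight : ∀ {P i j} → i < n → j < m → P i j ≡ true → BottomRight P
  bottomRight {P} {i} {j} i<n j<m Pij =
    let (r , r<n , (c₀ , c₀<m , Prc₀) , below) = greatest (rowOccupied? P) n (i , i<n , j , j<m , Pij)
        (c , c<m , Prc , right) = greatest (λ j → P r j Bool.≟ true) m (c₀ , c₀<m , Prc₀)
    in record { row = r ; col = c ; row<n = r<n ; col<m = c<m ; corner = Prc
              ; below-empty = λ r<r′ r′<n → unoccupied {P} (below r<r′ r′<n)
              ; right-empty = λ c<j j<m → ¬-not (right c<j j<m) }

  topLeft-row≤ : ∀ {P i j} (tl : TopLeft P) → j < m → P i j ≡ true → TopLeft.row tl ≤ i
  topLeft-row≤ tl j<m Pij = ≮⇒≥ λ i<row → ≡true⇒≢false Pij (TopLeft.above-empty tl i<row j<m)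

  bottomRight-row≥ : ∀ {P i j} (br : BottomRight P) → i < n → j < m → P i j ≡ true →
                     i ≤ BottomRight.row br
  bottomRight-row≥ br i<n j<m Pij =
    ≮⇒≥ λ row<i → ≡true⇒≢false Pij (BottomRight.below-empty br row<i i<n j<m)

  topLeft-degree : ∀ {P} (tl : TopLeft P) → let open TopLeft tl in
                   degreeIn P row col ≡ after n (λ r → P r col) row + after m (P row) col
  topLeft-degree {P} tl = cong₂ _+_
    (cong (_+ after n (λ r → P r col) row) (before-empty (λ r → P r col) λ r<row → above-empty r<row col<m))
    (cong (_+ after m (P row) col) (before-empty (P row) left-empty))
    where open TopLeft tl

  bottomRight-degree : ∀ {P} (br : BottomRight P) → let open BottomRight br in
                       degreeIn P row col ≡ before (λ r → P r col) row + before (P row) col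
  bottomRight-degree {P} br = cong₂ _+_
    (trans (cong (before (λ r → P r col) row +_)
                 (after-empty (λ r → P r col) λ row<r r<n → below-empty row<r r<n col<m))
           (+-identityʳ _))
    (trans (cong (before (P row) col +_) (after-empty (P row) right-empty)) (+-identityʳ _))
    where open BottomRight br

  topLeft-step : ∀ {P} (tl : TopLeft P) → let open TopLeft tl in
                 1 ≤ degreeIn P row col →
                 (suc row < n × P (suc row) col ≡ true) ⊎ (suc col < m × P row (suc col) ≡ true)
  topLeft-step {P} tl 1≤deg with one-of (subst (1 ≤_) (topLeft-degree tl) 1≤deg)
  ... | inj₁ 1≤down  = inj₁ (1≤after (λ r → P r (TopLeft.col tl)) 1≤down)
  ... | inj₂ 1≤right = inj₂ (1≤after (P (TopLeft.row tl)) 1≤right)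

  topLeft-steps : ∀ {P} (tl : TopLeft P) → let open TopLeft tl in
                  2 ≤ degreeIn P row col →
                  (suc row < n × P (suc row) col ≡ true) × (suc col < m × P row (suc col) ≡ true)
  topLeft-steps {P} tl 2≤deg =
    let (1≤down , 1≤right) = both-one (after≤1 n (λ r → P r col) row) (after≤1 m (P row) col)
                                      (subst (2 ≤_) (topLeft-degree tl) 2≤deg)
    in 1≤after (λ r → P r col) 1≤down , 1≤after (P row) 1≤right
    where open TopLeft tl

  bottomRight-steps : ∀ {P} (br : BottomRight P) → let open BottomRight br in
                      2 ≤ degreeIn P row col →
                      (∃[ r₀ ] (row ≡ suc r₀ × P r₀ col ≡ true)) × (∃[ c₀ ] (col ≡ suc c₀ × P row c₀ ≡ true))
  bottomRight-steps {P} br 2≤deg =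
    let (1≤up , 1≤left) = both-one (before≤1 (λ r → P r col) row) (before≤1 (P row) col)
                                   (subst (2 ≤_) (bottomRight-degree br) 2≤deg)
    in 1≤before (λ r → P r col) 1≤up , 1≤before (P row) 1≤left
    where open BottomRight br

  count-≥2 : ∀ {P i j} → MinDegree 1 P → i < n → j < m → P i j ≡ true → 2 ≤ count P
  count-≥2 {P} min i<n j<m Pij = by-step (topLeft-step tl (min row<n col<m corner))
    where
    tl : TopLeft P
    tl = topLeft i<n j<m Pij
    open TopLeft tl
    by-step : (suc row < n × P (suc row) col ≡ true) ⊎ (suc col < m × P row (suc col) ≡ true) →
              2 ≤ count P
    by-step (inj₁ (row+1<n , down)) =
      Σ<-≥-pair (rowCount P) ≤-refl row+1<n (rowCount-≥1 {P} col<m corner) (rowCount-≥1 {P} col<m down)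
    by-step (inj₂ (col+1<m , right)) = ≤Σ<-term (rowCount P) row<n (rowCount-≥2 {P} col+1<m corner right)

  module Extremes₂ {P : Cells} (min : MinDegree 2 P) {i j} (i<n : i < n) (j<m : j < m) (Pij : P i j ≡ true)
    where

    top : TopLeft P
    top = topLeft i<n j<m Pij

    bottom : BottomRight P
    bottom = bottomRight i<n j<m Pij

    module top = TopLeft top
    module bottom = BottomRight bottom

    down  : suc top.row < n × P (suc top.row) top.col ≡ true
    right : suc top.col < m × P top.row (suc top.col) ≡ true
    down  = proj₁ (topLeft-steps top (min top.row<n top.col<m top.corner))
    right = proj₂ (topLeft-steps top (min top.row<n top.col<m top.corner))

    up   : ∃[ r₀ ] (bottom.row ≡ suc r₀ × P r₀ bottom.col ≡ true)
    left : ∃[ c₀ ] (bottom.col ≡ suc c₀ × P bottom.row c₀ ≡ true)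
    up   = proj₁ (bottomRight-steps bottom (min bottom.row<n bottom.col<m bottom.corner))
    left = proj₂ (bottomRight-steps bottom (min bottom.row<n bottom.col<m bottom.corner))

    top<bottom : top.row < bottom.row
    top<bottom = bottomRight-row≥ bottom (proj₁ down) top.col<m (proj₂ down)

    top-pair : 2 ≤ rowCount P top.row
    top-pair = rowCount-≥2 {P} (proj₁ right) top.corner (proj₂ right)

    bottom-pair : 2 ≤ rowCount P bottom.row
    bottom-pair with left
    ... | _ , col≡ , P-left =
      rowCount-≥2 {P} (subst (_< m) col≡ bottom.col<m) P-left (subst (λ c → P bottom.row c ≡ true) col≡ bottom.corner)

  count-≥4 : ∀ {P i j} → MinDegree 2 P → i < n → j < m → P i j ≡ true → 4 ≤ count P
  count-≥4 {P} min i<n j<m Pij = Σ<-≥-pair (rowCount P) top<bottom bottom.row<n top-pair bottom-pair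
    where open Extremes₂ min i<n j<m Pij

  Indistinguishable : Cells → Cells → Set
  Indistinguishable f₁ f₂ = ∀ {a b i j} → a < n → b < m → i < n → j < m → Adjℕ (a , b) (i , j) →
                            (f₁ a b xor f₂ a b) ≡ true → (f₁ i j ∨ f₂ i j) ≡ true

  indistinguishable-sym : ∀ {f₁ f₂} → Indistinguishable f₁ f₂ → Indistinguishable f₂ f₁
  indistinguishable-sym {f₁} {f₂} indist {a} {b} {i} {j} a<n b<m i<n j<m adj D≡ =
    trans (∨-comm (f₂ i j) (f₁ i j)) (indist a<n b<m i<n j<m adj (trans (xor-comm (f₁ a b) (f₂ a b)) D≡))

  minDegree-difference : ∀ {g f₁ f₂} → Indistinguishable f₁ f₂ → MinDegree g (∁ f₁) →
                         MinDegree g (λ i j → f₂ i j ∧ not (f₁ i j))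
  minDegree-difference {g} {f₁} {f₂} indist good {i} {j} i<n j<m Aij =
    ≤-trans (good i<n j<m (outside Aij)) (degreeIn-mono i<n j<m λ x<n y<m adj ∁f₁xy →
      enters ∁f₁xy (indist i<n j<m x<n y<m adj (differs Aij)))
    where
    outside : (f₂ i j ∧ not (f₁ i j)) ≡ true → ∁ f₁ i j ≡ true
    outside _ with f₁ i j | f₂ i j
    outside () | true  | true
    outside () | true  | false
    outside _  | false | _ = refl
    differs : (f₂ i j ∧ not (f₁ i j)) ≡ true → (f₁ i j xor f₂ i j) ≡ true
    differs _ with f₁ i j | f₂ i j
    differs _  | false | true  = refl
    differs () | true  | true
    differs () | true  | false
    differs () | false | false
    enters : ∀ {x y} → ∁ f₁ x y ≡ true → (f₁ x y ∨ f₂ x y) ≡ true → (f₂ x y ∧ not (f₁ x y)) ≡ true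
    enters {x} {y} _ _ with f₁ x y | f₂ x y
    enters () _  | true  | _
    enters _  _  | false | true  = refl
    enters _  () | false | false

  module Pair {f₁ f₂ : Cells} (indist : Indistinguishable f₁ f₂) where

    A B C D : Cells
    A i j = f₂ i j ∧ not (f₁ i j)
    B i j = f₁ i j ∧ not (f₂ i j)
    C i j = f₁ i j ∧ f₂ i j
    D i j = f₁ i j xor f₂ i j

    d c w : ℕ → ℕ
    d = rowCount D
    c = rowCount C
    w r = d r + (c r + c r)

    A⇒D : ∀ {i j} → A i j ≡ true → D i j ≡ true
    A⇒D {i} {j} A≡ with f₁ i j | f₂ i j
    A⇒D _  | false | true  = refl
    A⇒D () | true  | true
    A⇒D () | true  | false
    A⇒D () | false | false

    B⇒D : ∀ {i j} → B i j ≡ true → D i j ≡ true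
    B⇒D {i} {j} B≡ with f₁ i j | f₂ i j
    B⇒D _  | true  | false = refl
    B⇒D () | true  | true
    B⇒D () | false | true
    B⇒D () | false | false

    D⇒A⊎B : ∀ {i j} → D i j ≡ true → A i j ≡ true ⊎ B i j ≡ true
    D⇒A⊎B {i} {j} D≡ with f₁ i j | f₂ i j
    D⇒A⊎B refl | false | true  = inj₁ refl
    D⇒A⊎B refl | true  | false = inj₂ refl
    D⇒A⊎B ()   | true  | true
    D⇒A⊎B ()   | false | false

    exit-in-C : ∀ {a b i j} → a < n → b < m → i < n → j < m → Adjℕ (a , b) (i , j) →
                D a b ≡ true → D i j ≡ false → C i j ≡ true
    exit-in-C {i = i} {j} a<n b<m i<n j<m adj Dab Dij
      with f₁ i j | f₂ i j | indist a<n b<m i<n j<m adj Dab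
    ... | true  | true  | _ = refl
    exit-in-C _ _ _ _ _ _ () | true  | false | _
    exit-in-C _ _ _ _ _ _ () | false | true  | _
    ... | false | false | ()

    D-row-meets-C-or-full : ∀ {r j} → r < n → j < m → D r j ≡ true → 1 ≤ c r ⊎ m ≤ d r
    D-row-meets-C-or-full {r} {j} r<n j<m Drj with constant-or-change (D r) m
    ... | inj₁ constant =
      inj₂ (n≤Σ< m λ k<m → ind-true (trans (constant k<m) (trans (sym (constant j<m)) Drj)))
    ... | inj₂ (k , k+1<m , change) with D r k in Drk | D r (suc k) in Drk+1
    ...   | true  | true  = ⊥-elim (change refl)
    ...   | false | false = ⊥-elim (change refl)
    ...   | true  | false = inj₁ (rowCount-≥1 {C} k+1<m
              (exit-in-C r<n (<-trans (n<1+n k) k+1<m) r<n k+1<m (inj₁ (refl , inj₁ refl)) Drk Drk+1))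
    ...   | false | true  = inj₁ (rowCount-≥1 {C} (<-trans (n<1+n k) k+1<m)
              (exit-in-C r<n k+1<m r<n (<-trans (n<1+n k) k+1<m) (inj₁ (refl , inj₂ refl)) Drk+1 Drk))

    d≤c+d : ∀ {r s} → r < n → s < n → PathAdjℕ r s → d r ≤ c s + d s
    d≤c+d {r} {s} r<n s<n r~s =
      subst (d r ≤_) (Σ<-+ m (λ j → ind (C s j)) (λ j → ind (D s j))) (Σ<-mono-≤ m covered)
      where
      covered : ∀ {j} → j < m → ind (D r j) ≤ ind (C s j) + ind (D s j)
      covered {j} j<m with D r j in Drj
      ... | false = z≤n
      ... | true with f₁ s j | f₂ s j | indist r<n j<m s<n j<m (inj₂ (refl , r~s)) Drj
      ...   | true  | true  | _ = ≤-refl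
      ...   | true  | false | _ = ≤-refl
      ...   | false | true  | _ = ≤-refl
      ...   | false | false | ()

    d≤c-of-D-free-neighbour : ∀ {r s} → r < n → s < n → PathAdjℕ r s → (∀ {j} → j < m → D s j ≡ false) →
                              d r ≤ c s
    d≤c-of-D-free-neighbour {r} {s} r<n s<n r~s empty =
      subst (d r ≤_) (trans (cong (c s +_) (rowCount-≡0 {D} empty)) (+-identityʳ (c s))) (d≤c+d r<n s<n r~s)

    minDegree-A : ∀ {g} → MinDegree g (∁ f₁) → MinDegree g A
    minDegree-A = minDegree-difference indist

    minDegree-B : ∀ {g} → MinDegree g (∁ f₂) → MinDegree g B
    minDegree-B = minDegree-difference (indistinguishable-sym {f₁} {f₂} indist)

    minDegree-D : ∀ {g} → MinDegree g A → MinDegree g B → MinDegree g D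
    minDegree-D minA minB i<n j<m Dij with D⇒A⊎B Dij
    ... | inj₁ Aij = ≤-trans (minA i<n j<m Aij) (degreeIn-mono i<n j<m λ _ _ _ → A⇒D)
    ... | inj₂ Bij = ≤-trans (minB i<n j<m Bij) (degreeIn-mono i<n j<m λ _ _ _ → B⇒D)

    count-f₂≡A+C : count f₂ ≡ count A + count C
    count-f₂≡A+C = count-split split
      where
      split : ∀ i j → ind (f₂ i j) ≡ ind (A i j) + ind (C i j)
      split i j with f₁ i j | f₂ i j
      ... | true  | true  = refl
      ... | true  | false = refl
      ... | false | true  = refl
      ... | false | false = refl

    count-f₁+count-f₂≡Σw : count f₁ + count f₂ ≡ Σ< n w
    count-f₁+count-f₂≡Σw = trans (sym (Σ<-+ n (rowCount f₁) (rowCount f₂))) (Σ<-cong n λ {r} _ → row r)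
      where
      cell : ∀ r j → ind (f₁ r j) + ind (f₂ r j) ≡ ind (D r j) + (ind (C r j) + ind (C r j))
      cell r j with f₁ r j | f₂ r j
      ... | true  | true  = refl
      ... | true  | false = refl
      ... | false | true  = refl
      ... | false | false = refl
      row : ∀ r → rowCount f₁ r + rowCount f₂ r ≡ w r
      row r = begin
        rowCount f₁ r + rowCount f₂ r                          ≡⟨ sym (Σ<-+ m _ _) ⟩
        Σ< m (λ j → ind (f₁ r j) + ind (f₂ r j))               ≡⟨ Σ<-cong m (λ {j} _ → cell r j) ⟩
        Σ< m (λ j → ind (D r j) + (ind (C r j) + ind (C r j))) ≡⟨ Σ<-+ m _ _ ⟩
        d r + Σ< m (λ j → ind (C r j) + ind (C r j))           ≡⟨ cong (d r +_) (Σ<-+ m _ _) ⟩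
        w r                                                    ∎
        where open ≡-Reasoning

    d≤w : ∀ r → d r ≤ w r
    d≤w r = m≤m+n (d r) (c r + c r)

    c+d≤w : ∀ r → c r + d r ≤ w r
    c+d≤w r = subst (_≤ w r) (+-comm (d r) (c r)) (+-monoʳ-≤ (d r) (m≤n+m (c r) (c r)))

    w+d-≥ : ∀ {x} r → x ≤ c r + d r → x + x ≤ w r + d r
    w+d-≥ {x} r x≤ =
      subst (x + x ≤_) (solve 2 (λ c d → (c :+ d) :+ (c :+ d) := (d :+ (c :+ c)) :+ d) refl (c r) (d r))
                       (+-mono-≤ x≤ x≤)

    -- Each row next to a full row holds ≥ m cells of C ∪ D; a border row has only one such
    -- neighbour, but the D-cells of that neighbour are counted again in the row after it.
    Σw-≥-3m : 3 ≤ n → ∀ r → r < n → m ≤ d r → m + m + m ≤ Σ< n w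
    Σw-≥-3m 3≤n zero 0<n full =
      ≤-trans (subst₂ _≤_ (sym (+-assoc m m m)) (sym (+-assoc m (w 1) (d 1)))
                      (+-monoʳ-≤ m (w+d-≥ 1 (≤-trans full (d≤c+d 0<n 1<n (inj₁ refl))))))
              (Σ<-≥-triple w ≤-refl ≤-refl 3≤n (≤-trans full (d≤w 0)) ≤-refl
                           (≤-trans (d≤c+d 1<n 3≤n (inj₁ refl)) (c+d≤w 2)))
      where
      1<n : 1 < n
      1<n = <-trans ≤-refl 3≤n
    Σw-≥-3m 3≤n (suc r₀) r<n full with suc (suc r₀) <? n
    ... | yes r+1<n =
      Σ<-≥-triple w (n<1+n r₀) (n<1+n (suc r₀)) r+1<n
        (≤-trans full (≤-trans (d≤c+d r<n r₀<n (inj₂ refl)) (c+d≤w r₀))) (≤-trans full (d≤w (suc r₀)))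
        (≤-trans full (≤-trans (d≤c+d r<n r+1<n (inj₁ refl)) (c+d≤w (suc (suc r₀)))))
      where
      r₀<n : r₀ < n
      r₀<n = <-trans (n<1+n r₀) r<n
    Σw-≥-3m 3≤n (suc zero) r<n full | no r+1≮n = ⊥-elim (r+1≮n 3≤n)
    Σw-≥-3m 3≤n (suc (suc r₁)) r<n full | no _ =
      ≤-trans (+-monoˡ-≤ m (subst (m + m ≤_) (+-comm (w (suc r₁)) (d (suc r₁)))
                                (w+d-≥ (suc r₁) (≤-trans full (d≤c+d r<n r₁+1<n (inj₂ refl))))))
              (Σ<-≥-triple w (n<1+n r₁) (n<1+n (suc r₁)) r<n
                (≤-trans (d≤c+d r₁+1<n r₁<n (inj₂ refl)) (c+d≤w r₁)) ≤-refl (≤-trans full (d≤w _)))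
      where
      r₁+1<n : suc r₁ < n
      r₁+1<n = <-trans (n<1+n (suc r₁)) r<n
      r₁<n : r₁ < n
      r₁<n = <-trans (n<1+n r₁) r₁+1<n

    full-D-row-bound : 3 ≤ n → ∀ {r} → r < n → m ≤ d r → m + m + m ≤ count f₁ + count f₂
    full-D-row-bound 3≤n {r} r<n full =
      subst (m + m + m ≤_) (sym count-f₁+count-f₂≡Σw) (Σw-≥-3m 3≤n r r<n full)

    module NoFullRow (not-full : ∀ {r} → r < n → d r < m) where

      D-row-meets-C : ∀ {r j} → r < n → j < m → D r j ≡ true → 1 ≤ c r
      D-row-meets-C r<n j<m Drj with D-row-meets-C-or-full r<n j<m Drj
      ... | inj₁ meets = meets
      ... | inj₂ full   = ⊥-elim (<⇒≱ (not-full r<n) full)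

      row-next-to-D-row-meets-C : ∀ {r j s} → r < n → j < m → D r j ≡ true → s < n → PathAdjℕ r s →
                                  1 ≤ c s
      row-next-to-D-row-meets-C {s = s} r<n j<m Drj s<n r~s with rowOccupied? D s
      ... | yes (j′ , j′<m , Dsj′) = D-row-meets-C s<n j′<m Dsj′
      ... | no  empty =
        ≤-trans (rowCount-≥1 {D} j<m Drj) (d≤c-of-D-free-neighbour r<n s<n r~s (unoccupied {D} empty))

      count-C-≥2 : 2 ≤ n → ∀ {i j} → i < n → j < m → D i j ≡ true → 2 ≤ count C
      count-C-≥2 2≤n i<n j<m Dij =
        let (s , s<n , i~s) = adjacentRow 2≤n i<n
        in Σ<-≥-adjacent c i<n s<n i~s (D-row-meets-C i<n j<m Dij)
                                       (row-next-to-D-row-meets-C i<n j<m Dij s<n i~s)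

      count-C-≥3-of-two-D-rows : 3 ≤ n → ∀ {i i′ j j′} → i < i′ → i′ < n → j < m → j′ < m →
                                 D i j ≡ true → D i′ j′ ≡ true → 3 ≤ count C
      count-C-≥3-of-two-D-rows 3≤n {suc i₀} i<i′ i′<n j<m j′<m Dij Di′j′ =
        Σ<-≥-triple c ≤-refl i<i′ i′<n (row-next-to-D-row-meets-C i<n j<m Dij (<-trans ≤-refl i<n) (inj₂ refl))
                                       (D-row-meets-C i<n j<m Dij) (D-row-meets-C i′<n j′<m Di′j′)
        where
        i<n : suc i₀ < n
        i<n = <-trans i<i′ i′<n
      count-C-≥3-of-two-D-rows 3≤n {zero} {i′} 0<i′ i′<n j<m j′<m D0j Di′j′ with m≤n⇒m<n∨m≡n 0<i′
      ... | inj₁ 1<i′ =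
        Σ<-≥-triple c ≤-refl 1<i′ i′<n (D-row-meets-C 0<n j<m D0j)
                                      (row-next-to-D-row-meets-C 0<n j<m D0j (<-trans 1<i′ i′<n) (inj₁ refl))
                                      (D-row-meets-C i′<n j′<m Di′j′)
        where
        0<n : 0 < n
        0<n = <-trans 0<i′ i′<n
      ... | inj₂ 1≡i′ =
        Σ<-≥-triple c 0<i′ ≤-refl i′+1<n (D-row-meets-C (<-trans 0<i′ i′<n) j<m D0j)
                                         (D-row-meets-C i′<n j′<m Di′j′)
                                         (row-next-to-D-row-meets-C i′<n j′<m Di′j′ i′+1<n (inj₁ refl))
        where
        i′+1<n : suc i′ < n
        i′+1<n = subst (λ x → suc x < n) 1≡i′ 3≤n

      count-C-≥3 : 3 ≤ n → MinDegree 1 D → ∀ {i j} → i < n → j < m → D i j ≡ true → 3 ≤ count C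
      count-C-≥3 3≤n min i<n j<m Dij = by-extent (m≤n⇒m<n∨m≡n (topLeft-row≤ top bottom.col<m bottom.corner))
        where
        top : TopLeft D
        top = topLeft i<n j<m Dij
        bottom : BottomRight D
        bottom = bottomRight i<n j<m Dij
        module top = TopLeft top
        module bottom = BottomRight bottom
        other-rows-empty : top.row ≡ bottom.row → ∀ {s j} → s ≢ top.row → s < n → j < m → D s j ≡ false
        other-rows-empty top≡bottom {s} s≢top s<n j<m with <-cmp s top.row
        ... | tri< s<top _ _ = top.above-empty s<top j<m
        ... | tri≈ _ s≡top _ = ⊥-elim (s≢top s≡top)
        ... | tri> _ _ top<s = bottom.below-empty (subst (_< s) top≡bottom top<s) s<n j<m
        single-row : top.row ≡ bottom.row → 3 ≤ count C
        single-row top≡bottom with topLeft-step top (min top.row<n top.col<m top.corner)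
        ... | inj₁ (row+1<n , down) =
          ⊥-elim (<⇒≱ ≤-refl (subst (suc top.row ≤_) (sym top≡bottom)
                                     (bottomRight-row≥ bottom row+1<n top.col<m down)))
        ... | inj₂ (col+1<m , right) =
          let (s , s<n , top~s) = adjacentRow (<-trans (s≤s (s≤s z≤n)) 3≤n) top.row<n
          in Σ<-≥-adjacent c top.row<n s<n top~s (D-row-meets-C top.row<n top.col<m top.corner)
               (≤-trans (rowCount-≥2 {D} col+1<m top.corner right)
                        (d≤c-of-D-free-neighbour top.row<n s<n top~s
                                                 (other-rows-empty top≡bottom (adjacent≢ top~s) s<n)))
        by-extent : top.row < bottom.row ⊎ top.row ≡ bottom.row → 3 ≤ count C
        by-extent (inj₁ top<bottom) =
          count-C-≥3-of-two-D-rows 3≤n top<bottom bottom.row<n top.col<m bottom.col<m top.corner bottom.corner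
        by-extent (inj₂ top≡bottom) = single-row top≡bottom

      -- The row above the top D-row or the row below the bottom one is D-free and next to a row
      -- with ≥ 2 D-cells; if neither exists, rows 0, 1, n − 2 and n − 1 are D-rows.
      count-C-≥4 : 5 ≤ n → MinDegree 2 D → ∀ {i j} → i < n → j < m → D i j ≡ true → 4 ≤ count C
      count-C-≥4 5≤n min i<n j<m Dij = by-top top.row refl
        where
        open Extremes₂ min i<n j<m Dij
        top-meets-C : 1 ≤ c top.row
        top-meets-C = D-row-meets-C top.row<n top.col<m top.corner
        bottom-meets-C : 1 ≤ c bottom.row
        bottom-meets-C = D-row-meets-C bottom.row<n bottom.col<m bottom.corner
        by-top : ∀ t → t ≡ top.row → 4 ≤ count C
        by-top (suc t₀) t≡top = Σ<-≥-triple c t₀<top top<bottom bottom.row<n above-top top-meets-C bottom-meets-C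
          where
          t₀<top : t₀ < top.row
          t₀<top = subst (t₀ <_) t≡top ≤-refl
          above-top : 2 ≤ c t₀
          above-top = ≤-trans top-pair (d≤c-of-D-free-neighbour top.row<n (<-trans t₀<top top.row<n) (inj₂ t≡top)
                                                                 (top.above-empty t₀<top))
        by-top zero 0≡top with suc bottom.row <? n
        ... | yes bottom+1<n = Σ<-≥-triple c top<bottom ≤-refl bottom+1<n top-meets-C bottom-meets-C below-bottom
          where
          below-bottom : 2 ≤ c (suc bottom.row)
          below-bottom = ≤-trans bottom-pair (d≤c-of-D-free-neighbour bottom.row<n bottom+1<n (inj₁ refl)
                                                                       (bottom.below-empty ≤-refl bottom+1<n))
        ... | no bottom+1≮n with up
        ...   | p , bottom≡ , D-up =
          ≤Σ<-+term c bottom.row<n (Σ<-≥-triple c ≤-refl top+1<p p<bottom top-meets-C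
                                                (D-row-meets-C (proj₁ down) top.col<m (proj₂ down))
                                                (D-row-meets-C (<-trans p<bottom bottom.row<n) bottom.col<m D-up))
                    bottom-meets-C
          where
          p<bottom : p < bottom.row
          p<bottom = subst (p <_) (sym bottom≡) ≤-refl
          top+1<p : suc top.row < p
          top+1<p = subst (λ x → suc x < p) 0≡top (≤-trans (n≤1+n 2) 3≤p)
            where
            3≤p : 3 ≤ p
            3≤p = s≤s⁻¹ (s≤s⁻¹ (subst (5 ≤_) (cong suc bottom≡) (≤-trans 5≤n (≮⇒≥ bottom+1≮n))))

    A-cell : ∀ {a b} → f₁ a b ≡ false → f₂ a b ≡ true → A a b ≡ true
    A-cell f₁≡ f₂≡ rewrite f₁≡ | f₂≡ = refl

    full-D-row? : (∃[ r ] (r < n × m ≤ d r)) ⊎ (∀ {r} → r < n → d r < m)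
    full-D-row? with anyUpTo? (λ r → m ≤? d r) n
    ... | yes full = inj₁ full
    ... | no  none = inj₂ λ r<n → ≰⇒> λ m≤ → none (_ , r<n , m≤)

    lower-bound : ∀ {K} → 3 ≤ n → 5 ≤ m → K ≤ 8 → ((∀ {r} → r < n → d r < m) → K ≤ count f₂) →
                  K ≤ count f₁ ⊎ K ≤ count f₂
    lower-bound 3≤n 5≤m K≤8 light with full-D-row?
    ... | inj₂ not-full = inj₂ (light not-full)
    ... | inj₁ (r , r<n , full) =
      Sum.map (≤-trans K≤8) (≤-trans K≤8)
              (larger-half 7 (≤-trans (+-mono-≤ (+-mono-≤ 5≤m 5≤m) 5≤m) (full-D-row-bound 3≤n r<n full)))

  Forces : ℕ → ℕ → Set
  Forces g K = ∀ {f₁ f₂} → MinDegree g (∁ f₁) → MinDegree g (∁ f₂) → Indistinguishable f₁ f₂ →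
               ∀ {a b} → a < n → b < m → f₁ a b ≡ false → f₂ a b ≡ true → K ≤ count f₁ ⊎ K ≤ count f₂

  forces₀ : 5 ≤ n → 5 ≤ m → Forces 0 3
  forces₀ 5≤n 5≤m {f₁} {f₂} _ _ indist a<n b<m f₁ab f₂ab =
    lower-bound (≤-trans (≤ᵇ⇒≤ 3 5 _) 5≤n) 5≤m (≤ᵇ⇒≤ 3 8 _) λ not-full →
      subst (3 ≤_) (sym count-f₂≡A+C)
        (+-mono-≤ (count-≥1 a<n b<m (A-cell f₁ab f₂ab))
                  (NoFullRow.count-C-≥2 not-full (≤-trans (≤ᵇ⇒≤ 2 5 _) 5≤n) a<n b<m (A⇒D (A-cell f₁ab f₂ab))))
    where open Pair {f₁} {f₂} indist

  forces₁ : 5 ≤ n → 5 ≤ m → Forces 1 5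
  forces₁ 5≤n 5≤m {f₁} {f₂} good₁ good₂ indist a<n b<m f₁ab f₂ab =
    lower-bound 3≤n 5≤m (≤ᵇ⇒≤ 5 8 _) λ not-full →
      subst (5 ≤_) (sym count-f₂≡A+C)
        (+-mono-≤ (count-≥2 (minDegree-A good₁) a<n b<m (A-cell f₁ab f₂ab))
                  (NoFullRow.count-C-≥3 not-full 3≤n (minDegree-D (minDegree-A good₁) (minDegree-B good₂))
                                  a<n b<m (A⇒D (A-cell f₁ab f₂ab))))
    where
    open Pair {f₁} {f₂} indist
    3≤n : 3 ≤ n
    3≤n = ≤-trans (≤ᵇ⇒≤ 3 5 _) 5≤n

  forces₂ : 5 ≤ n → 5 ≤ m → Forces 2 8
  forces₂ 5≤n 5≤m {f₁} {f₂} good₁ good₂ indist a<n b<m f₁ab f₂ab =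
    lower-bound (≤-trans (≤ᵇ⇒≤ 3 5 _) 5≤n) 5≤m ≤-refl λ not-full →
      subst (8 ≤_) (sym count-f₂≡A+C)
        (+-mono-≤ (count-≥4 (minDegree-A good₁) a<n b<m (A-cell f₁ab f₂ab))
                  (NoFullRow.count-C-≥4 not-full 5≤n (minDegree-D (minDegree-A good₁) (minDegree-B good₂))
                                  a<n b<m (A⇒D (A-cell f₁ab f₂ab))))
    where open Pair {f₁} {f₂} indist

-- Vertex sets as cells

sum-allFin : ∀ k (f : Fin k → ℕ) (g : ℕ → ℕ) → (∀ i → f i ≡ g (toℕ i)) →
             sum (map f (allFin k)) ≡ Σ< k g
sum-allFin k f g f≗g = trans (cong sum (map-tabulate id f)) (sum-tabulate k f g f≗g)
  where
  Σ<-shift : ∀ k g → Σ< (suc k) g ≡ g 0 + Σ< k (g ∘ suc)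
  Σ<-shift zero    g = +-comm 0 (g 0)
  Σ<-shift (suc k) g = trans (cong (_+ g (suc k)) (Σ<-shift k g)) (+-assoc (g 0) _ _)
  sum-tabulate : ∀ k (f : Fin k → ℕ) (g : ℕ → ℕ) → (∀ i → f i ≡ g (toℕ i)) →
                 sum (tabulate f) ≡ Σ< k g
  sum-tabulate zero    f g f≗g = refl
  sum-tabulate (suc k) f g f≗g =
    trans (cong₂ _+_ (f≗g Fin.zero) (sum-tabulate k (f ∘ Fin.suc) (g ∘ suc) (f≗g ∘ Fin.suc)))
          (sym (Σ<-shift k g))

Adj⇔Adjℕ : ∀ {n m} (u v : Vertex n m) →
           Adj u v ⇔ Adjℕ (toℕ (proj₁ u) , toℕ (proj₂ u)) (toℕ (proj₁ v) , toℕ (proj₂ v))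
Adj⇔Adjℕ u v = mk⇔ to from
  where
  to : Adj u v → _
  to (inj₁ (a≡i , b~j)) = inj₁ (cong toℕ a≡i , b~j)
  to (inj₂ (a~i , b≡j)) = inj₂ (cong toℕ b≡j , a~i)
  from : _ → Adj u v
  from (inj₁ (a≡i , b~j)) = inj₁ (toℕ-injective a≡i , b~j)
  from (inj₂ (b≡j , a~i)) = inj₂ (a~i , toℕ-injective b≡j)

module Lift (n m : ℕ) where
  open Grid n m

  lift : VSet n m → Cells
  lift F i j with i <? n | j <? m
  ... | yes i<n | yes j<m = F (fromℕ< i<n , fromℕ< j<m)
  ... | _       | _       = false

  lift-fromℕ< : ∀ F {i j} (i<n : i < n) (j<m : j < m) → lift F i j ≡ F (fromℕ< i<n , fromℕ< j<m)
  lift-fromℕ< F {i} {j} i<n j<m with i <? n | j <? m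
  ... | yes _  | yes _  = refl
  ... | no i≮n | _      = ⊥-elim (i≮n i<n)
  ... | yes _  | no j≮m = ⊥-elim (j≮m j<m)

  lift-toℕ : ∀ F (u : Vertex n m) → lift F (toℕ (proj₁ u)) (toℕ (proj₂ u)) ≡ F u
  lift-toℕ F (a , b) =
    trans (lift-fromℕ< F (toℕ<n a) (toℕ<n b)) (cong₂ (λ x y → F (x , y)) (fromℕ<-toℕ a _) (fromℕ<-toℕ b _))

  restrict : Cells → VSet n m
  restrict P (a , b) = P (toℕ a) (toℕ b)

  lift-restrict : ∀ P {i j} → i < n → j < m → lift (restrict P) i j ≡ P i j
  lift-restrict P i<n j<m =
    trans (lift-fromℕ< (restrict P) i<n j<m) (cong₂ P (toℕ-fromℕ< i<n) (toℕ-fromℕ< j<m))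

  size-lift : ∀ F → size F ≡ count (lift F)
  size-lift F = sum-allFin n _ (rowCount (lift F)) λ a →
    sum-allFin m _ (λ j → ind (lift F (toℕ a) j)) λ b → cong ind (sym (lift-toℕ F (a , b)))

  outsideDeg-lift : ∀ F (u : Vertex n m) →
                    outsideDeg F u ≡ degreeIn (∁ (lift F)) (toℕ (proj₁ u)) (toℕ (proj₂ u))
  outsideDeg-lift F u@(a , b) =
    trans (size-lift _) (trans (count-cong cell) (count-adjacent≡degreeIn (∁ (lift F)) (toℕ<n a) (toℕ<n b)))
    where
    cell : ∀ {i j} → i < n → j < m →
           lift (λ v → ⌊ adj? u v ⌋ ∧ not (F v)) i j ≡ does (adjℕ? (toℕ a , toℕ b) (i , j)) ∧ ∁ (lift F) i j
    cell {i} {j} i<n j<m = begin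
      lift (λ v → ⌊ adj? u v ⌋ ∧ not (F v)) i j
        ≡⟨ lift-fromℕ< _ i<n j<m ⟩
      ⌊ adj? u v ⌋ ∧ not (F v)
        ≡⟨ cong₂ (λ x y → x ∧ not y)
                 (trans (isYes≗does (adj? u v)) (does-⇔ (Adj⇔Adjℕ u v) (adj? u v) (adjℕ? _ _)))
                 (sym (lift-fromℕ< F i<n j<m)) ⟩
      does (adjℕ? (toℕ a , toℕ b) (toℕ (fromℕ< i<n) , toℕ (fromℕ< j<m))) ∧ ∁ (lift F) i j
        ≡⟨ cong₂ (λ x y → does (adjℕ? (toℕ a , toℕ b) (x , y)) ∧ ∁ (lift F) i j)
                 (toℕ-fromℕ< i<n) (toℕ-fromℕ< j<m) ⟩
      does (adjℕ? (toℕ a , toℕ b) (i , j)) ∧ ∁ (lift F) i j ∎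
      where
      open ≡-Reasoning
      v : Vertex n m
      v = (fromℕ< i<n , fromℕ< j<m)

  minDegree-lift : ∀ {g} F → GoodNeighborFaulty g F → MinDegree g (∁ (lift F))
  minDegree-lift {g} F good {i} {j} i<n j<m outside =
    subst₂ (λ x y → g ≤ degreeIn (∁ (lift F)) x y) (toℕ-fromℕ< i<n) (toℕ-fromℕ< j<m)
      (subst (g ≤_) (outsideDeg-lift F v)
                    (good v (trans (sym (lift-fromℕ< F i<n j<m)) (not≡true⇒≡false outside))))
    where
    v : Vertex n m
    v = (fromℕ< i<n , fromℕ< j<m)

  goodNeighbor-restrict : ∀ {g} P → MinDegree g (∁ P) → GoodNeighborFaulty g (restrict P)
  goodNeighbor-restrict {g} P min u@(a , b) Pu≡false =
    subst (g ≤_) (sym (outsideDeg-lift (restrict P) u))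
      (≤-trans (min (toℕ<n a) (toℕ<n b) (cong not Pu≡false))
               (degreeIn-mono (toℕ<n a) (toℕ<n b) λ x<n y<m _ ∁P≡ →
                  trans (cong not (lift-restrict P x<n y<m)) ∁P≡))

  indistinguishable-lift : ∀ F₁ F₂ → ¬ Distinguishable F₁ F₂ → Indistinguishable (lift F₁) (lift F₂)
  indistinguishable-lift F₁ F₂ ¬dist {a} {b} {i} {j} a<n b<m i<n j<m adj D≡
    with lift F₁ i j in F₁v | lift F₂ i j in F₂v
  ... | true  | _    = refl
  ... | false | true = refl
  ... | false | false = ⊥-elim (¬dist (u , v , differs , trans (sym (lift-fromℕ< F₁ i<n j<m)) F₁v
                                             , trans (sym (lift-fromℕ< F₂ i<n j<m)) F₂v , adjacent))
    where
    u : Vertex n m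
    u = (fromℕ< a<n , fromℕ< b<m)
    v : Vertex n m
    v = (fromℕ< i<n , fromℕ< j<m)
    differs : (F₁ u xor F₂ u) ≡ true
    differs = trans (sym (cong₂ _xor_ (lift-fromℕ< F₁ a<n b<m) (lift-fromℕ< F₂ a<n b<m))) D≡
    adjacent : Adj u v
    adjacent = Equivalence.from (Adj⇔Adjℕ u v)
      (subst₂ Adjℕ (sym (cong₂ _,_ (toℕ-fromℕ< a<n) (toℕ-fromℕ< b<m)))
                   (sym (cong₂ _,_ (toℕ-fromℕ< i<n) (toℕ-fromℕ< j<m))) adj)

  ¬distinguishable-restrict : ∀ P₁ P₂ → Indistinguishable P₁ P₂ →
                              ¬ Distinguishable (restrict P₁) (restrict P₂)
  ¬distinguishable-restrict P₁ P₂ indist (u@(a , b) , v@(i , j) , D≡ , P₁v , P₂v , adj) =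
    ≡true⇒≢false (indist (toℕ<n a) (toℕ<n b) (toℕ<n i) (toℕ<n j) (Equivalence.to (Adj⇔Adjℕ u v) adj) D≡)
                 (cong₂ _∨_ P₁v P₂v)

  anyVertex? : ∀ {P : Vertex n m → Set} → Decidable P → Dec (∃ P)
  anyVertex? P? =
    map′ (λ (i , j , p) → (i , j) , p) (λ ((i , j) , p) → i , j , p) (any? λ i → any? λ j → P? (i , j))

  distinguishable? : ∀ F₁ F₂ → Dec (Distinguishable F₁ F₂)
  distinguishable? F₁ F₂ = anyVertex? λ u → anyVertex? λ v →
    ((F₁ u xor F₂ u) Bool.≟ true) ×-dec (F₁ v Bool.≟ false) ×-dec (F₂ v Bool.≟ false) ×-dec adj? u v

  diagnosable : ∀ {g t} → Forces g (suc t) → Diagnosable n m g t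
  diagnosable {g} {t} forces F₁ F₂ good₁ good₂ size₁ size₂ (x@(a , b) , F₁x≢F₂x)
    with distinguishable? F₁ F₂
  ... | yes dist = dist
  ... | no ¬dist = ⊥-elim (too-large (by-cell (F₁ x) (F₂ x) refl refl))
    where
    indist : Indistinguishable (lift F₁) (lift F₂)
    indist = indistinguishable-lift F₁ F₂ ¬dist
    too-large : suc t ≤ count (lift F₁) ⊎ suc t ≤ count (lift F₂) → ⊥
    too-large (inj₁ t<F₁) = <⇒≱ t<F₁ (subst (_≤ t) (size-lift F₁) size₁)
    too-large (inj₂ t<F₂) = <⇒≱ t<F₂ (subst (_≤ t) (size-lift F₂) size₂)
    by-cell : ∀ x₁ x₂ → F₁ x ≡ x₁ → F₂ x ≡ x₂ → suc t ≤ count (lift F₁) ⊎ suc t ≤ count (lift F₂)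
    by-cell false true F₁x F₂x =
      forces (minDegree-lift F₁ good₁) (minDegree-lift F₂ good₂) indist (toℕ<n a) (toℕ<n b)
             (trans (lift-toℕ F₁ x) F₁x) (trans (lift-toℕ F₂ x) F₂x)
    by-cell true false F₁x F₂x = Sum.swap
      (forces (minDegree-lift F₂ good₂) (minDegree-lift F₁ good₁) (indistinguishable-sym {lift F₁} {lift F₂} indist)
              (toℕ<n a) (toℕ<n b) (trans (lift-toℕ F₂ x) F₂x) (trans (lift-toℕ F₁ x) F₁x))
    by-cell true  true  F₁x F₂x = ⊥-elim (F₁x≢F₂x (trans F₁x (sym F₂x)))
    by-cell false false F₁x F₂x = ⊥-elim (F₁x≢F₂x (trans F₁x (sym F₂x)))

  not-diagnosable : ∀ {g k} P₁ P₂ → MinDegree g (∁ P₁) → MinDegree g (∁ P₂) → Indistinguishable P₁ P₂ →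
                    ∀ {a b} → a < n → b < m → P₁ a b ≢ P₂ a b → count P₁ ≤ suc k → count P₂ ≤ suc k →
                    ∀ t → Diagnosable n m g t → t ≤ k
  not-diagnosable {g} {k} P₁ P₂ good₁ good₂ indist a<n b<m P₁≢P₂ size₁ size₂ t diag with t ≤? k
  ... | yes t≤k = t≤k
  ... | no  t≰k = ⊥-elim (¬distinguishable-restrict P₁ P₂ indist
                    (diag (restrict P₁) (restrict P₂) (goodNeighbor-restrict P₁ good₁) (goodNeighbor-restrict P₂ good₂)
                          (fits P₁ size₁) (fits P₂ size₂) distinct))
    where
    fits : ∀ P → count P ≤ suc k → size (restrict P) ≤ t
    fits P size≤ =
      ≤-trans (≤-reflexive (trans (size-lift (restrict P)) (count-cong (lift-restrict P)))) (≤-trans size≤ (≰⇒> t≰k))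
    distinct : Distinct (restrict P₁) (restrict P₂)
    distinct = (fromℕ< a<n , fromℕ< b<m) ,
               P₁≢P₂ ∘ subst₂ (λ x y → P₁ x y ≡ P₂ x y) (toℕ-fromℕ< a<n) (toℕ-fromℕ< b<m)

-- The extremal pairs

Table : Set
Table = Vec (Vec Bool 3) 3

fromTable : Table → Cells
fromTable t i j with i <? 3 | j <? 3
... | yes i<3 | yes j<3 = lookup (lookup t (fromℕ< i<3)) (fromℕ< j<3)
... | _       | _       = false

fromTable-outside : ∀ t {i j} → 3 ≤ i ⊎ 3 ≤ j → fromTable t i j ≡ false
fromTable-outside t {i} {j} outside with i <? 3 | j <? 3
... | yes i<3 | yes j<3 = ⊥-elim ([ <⇒≱ i<3 , <⇒≱ j<3 ]′ outside)
... | no  _   | _       = refl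
... | yes _   | no  _   = refl

corner-or-beyond : ∀ a b → (a < 3 × b < 3) ⊎ (3 ≤ a ⊎ 3 ≤ b)
corner-or-beyond a b with a <? 3 | b <? 3
... | yes a<3 | yes b<3 = inj₁ (a<3 , b<3)
... | no  a≮3 | _       = inj₂ (inj₁ (≮⇒≥ a≮3))
... | yes _   | no  b≮3 = inj₂ (inj₂ (≮⇒≥ b≮3))

decide-3×3 : ∀ {Q : ℕ → ℕ → Set} (Q? : ∀ a b → Dec (Q a b)) → True (allUpTo? (λ a → allUpTo? (Q? a) 3) 3) →
             ∀ {a b} → a < 3 → b < 3 → Q a b
decide-3×3 Q? holds a<3 b<3 = toWitness holds a<3 b<3

-- Evaluated in the 4 × 4 grid, where a cell of the 3 × 3 corner has the same neighbours as in
-- the n × m grid (degreeIn-near-corner).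
GoodAt : ℕ → Table → ℕ → ℕ → Set
GoodAt g t a b = fromTable t a b ≡ true ⊎ g ≤ Grid.degreeIn 4 4 (∁ (fromTable t)) a b

goodAt? : ∀ g t a b → Dec (GoodAt g t a b)
goodAt? g t a b = (fromTable t a b Bool.≟ true) ⊎-dec (g ≤? Grid.degreeIn 4 4 (∁ (fromTable t)) a b)

ClosedAt : Table → Table → ℕ → ℕ → Set
ClosedAt t₁ t₂ a b = (fromTable t₁ a b xor fromTable t₂ a b) ≡ false
                   ⊎ Grid.degreeIn 4 4 (∁ (λ i j → fromTable t₁ i j ∨ fromTable t₂ i j)) a b ≡ 0

closedAt? : ∀ t₁ t₂ a b → Dec (ClosedAt t₁ t₂ a b)
closedAt? t₁ t₂ a b = ((fromTable t₁ a b xor fromTable t₂ a b) Bool.≟ false)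
                    ⊎-dec (Grid.degreeIn 4 4 (∁ (λ i j → fromTable t₁ i j ∨ fromTable t₂ i j)) a b ≟ 0)

■ □ : Bool
■ = true
□ = false

boundary₀ closure₀ boundary₁ closure₁ boundary₂ closure₂ : Table
boundary₀ = (□ ∷ ■ ∷ □ ∷ []) ∷
            (■ ∷ □ ∷ □ ∷ []) ∷
            (□ ∷ □ ∷ □ ∷ []) ∷ []
closure₀  = (■ ∷ ■ ∷ □ ∷ []) ∷
            (■ ∷ □ ∷ □ ∷ []) ∷
            (□ ∷ □ ∷ □ ∷ []) ∷ []
boundary₁ = (□ ∷ □ ∷ ■ ∷ []) ∷
            (■ ∷ ■ ∷ □ ∷ []) ∷
            (□ ∷ □ ∷ □ ∷ []) ∷ []
closure₁  = (■ ∷ ■ ∷ ■ ∷ []) ∷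
            (■ ∷ ■ ∷ □ ∷ []) ∷
            (□ ∷ □ ∷ □ ∷ []) ∷ []
boundary₂ = (□ ∷ □ ∷ ■ ∷ []) ∷
            (□ ∷ □ ∷ ■ ∷ []) ∷
            (■ ∷ ■ ∷ □ ∷ []) ∷ []
closure₂  = (■ ∷ ■ ∷ ■ ∷ []) ∷
            (■ ∷ ■ ∷ ■ ∷ []) ∷
            (■ ∷ ■ ∷ □ ∷ []) ∷ []

module Witnesses (n m : ℕ) (5≤n : 5 ≤ n) (5≤m : 5 ≤ m) where
  open Grid n m

  degreeIn-near-corner : ∀ Q {a b} → a < 3 → b < 3 → degreeIn Q a b ≡ Grid.degreeIn 4 4 Q a b
  degreeIn-near-corner Q {a} {b} a<3 b<3 =
    cong₂ _+_ (pathDegree-resize (λ r → Q r b) (<-≤-trans (s≤s a<3) (≤-trans (n≤1+n 4) 5≤n)) (s≤s a<3))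
              (pathDegree-resize (Q a) (<-≤-trans (s≤s b<3) (≤-trans (n≤1+n 4) 5≤m)) (s≤s b<3))

  degreeIn-outside-corner : ∀ {P a b} → (∀ {i j} → 3 ≤ i ⊎ 3 ≤ j → P i j ≡ false) →
                            a < n → b < m → 3 ≤ a ⊎ 3 ≤ b → 2 ≤ degreeIn (∁ P) a b
  degreeIn-outside-corner {P} {a} {b} vanishes a<n b<m (inj₁ 3≤a) =
    +-mono-≤ (pathDegree-≥1 5≤n 3≤a a<n λ 3≤x → cong not (vanishes (inj₁ 3≤x)))
             (pathDegree-≥1 {0} (≤-trans (≤ᵇ⇒≤ 2 5 _) 5≤m) z≤n b<m λ _ → cong not (vanishes (inj₁ 3≤a)))
  degreeIn-outside-corner {P} {a} {b} vanishes a<n b<m (inj₂ 3≤b) =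
    +-mono-≤ (pathDegree-≥1 {0} (≤-trans (≤ᵇ⇒≤ 2 5 _) 5≤n) z≤n a<n λ _ → cong not (vanishes (inj₂ 3≤b)))
             (pathDegree-≥1 5≤m 3≤b b<m λ 3≤y → cong not (vanishes (inj₂ 3≤y)))

  count-table : ∀ t → count (fromTable t) ≡ Σ< 3 (λ i → Σ< 3 (λ j → ind (fromTable t i j)))
  count-table t =
    trans (Σ<-truncate (rowCount (fromTable t)) 3≤n
                       (λ {i} 3≤i _ → rowCount-≡0 {fromTable t} {i} λ {j} _ → fromTable-outside t {i} {j} (inj₁ 3≤i)))
          (Σ<-cong 3 λ {i} _ → Σ<-truncate (λ j → ind (fromTable t i j)) 3≤m
                                             (λ {j} 3≤j _ → cong ind (fromTable-outside t {i} {j} (inj₂ 3≤j))))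
    where
    3≤n : 3 ≤ n
    3≤n = ≤-trans (≤ᵇ⇒≤ 3 5 _) 5≤n
    3≤m : 3 ≤ m
    3≤m = ≤-trans (≤ᵇ⇒≤ 3 5 _) 5≤m

  table-minDegree : ∀ {g} t → g ≤ 2 → (∀ {a b} → a < 3 → b < 3 → GoodAt g t a b) → MinDegree g (∁ (fromTable t))
  table-minDegree {g} t g≤2 near {a} {b} a<n b<m outside with corner-or-beyond a b
  ... | inj₂ far = ≤-trans g≤2 (degreeIn-outside-corner (fromTable-outside t) a<n b<m far)
  ... | inj₁ (a<3 , b<3) with near a<3 b<3
  ...   | inj₁ inside = ⊥-elim (≡true⇒≢false inside (not≡true⇒≡false outside))
  ...   | inj₂ g≤deg  = subst (g ≤_) (sym (degreeIn-near-corner (∁ (fromTable t)) a<3 b<3)) g≤deg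

  tables-indistinguishable : ∀ t₁ t₂ → (∀ {a b} → a < 3 → b < 3 → ClosedAt t₁ t₂ a b) →
                             Indistinguishable (fromTable t₁) (fromTable t₂)
  tables-indistinguishable t₁ t₂ near {a} {b} {i} {j} a<n b<m i<n j<m adj D≡ with corner-or-beyond a b
  ... | inj₂ far rewrite fromTable-outside t₁ far | fromTable-outside t₂ far = ⊥-elim (≡true⇒≢false D≡ refl)
  ... | inj₁ (a<3 , b<3) with near a<3 b<3 | fromTable t₁ i j ∨ fromTable t₂ i j in U≡
  ...   | inj₁ D≡false | _     = ⊥-elim (≡true⇒≢false D≡ D≡false)
  ...   | inj₂ _       | true  = refl
  ...   | inj₂ no-exit | false =
    ⊥-elim (<-irrefl refl (≤-trans (adjacent-counted i<n j<m adj (cong not U≡))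
                                   (≤-reflexive (trans (degreeIn-near-corner _ a<3 b<3) no-exit))))

  count-table-≤ : ∀ t {k} → T (Σ< 3 (λ i → Σ< 3 (λ j → ind (fromTable t i j))) ≤ᵇ k) → count (fromTable t) ≤ k
  count-table-≤ t fits = ≤-trans (≤-reflexive (count-table t)) (≤ᵇ⇒≤ _ _ fits)

  open Lift n m

  0<n : 0 < n
  0<n = ≤-trans (≤ᵇ⇒≤ 1 5 _) 5≤n

  0<m : 0 < m
  0<m = ≤-trans (≤ᵇ⇒≤ 1 5 _) 5≤m

  upper₀ : ∀ t → Diagnosable n m 0 t → t ≤ 2
  upper₀ = not-diagnosable (fromTable boundary₀) (fromTable closure₀) (λ _ _ _ → z≤n) (λ _ _ _ → z≤n)
             (tables-indistinguishable boundary₀ closure₀ (decide-3×3 (closedAt? boundary₀ closure₀) _))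
             0<n 0<m (λ ()) (count-table-≤ boundary₀ _) (count-table-≤ closure₀ _)

  upper₁ : ∀ t → Diagnosable n m 1 t → t ≤ 4
  upper₁ = not-diagnosable (fromTable boundary₁) (fromTable closure₁)
             (table-minDegree boundary₁ (≤ᵇ⇒≤ 1 2 _) (decide-3×3 (goodAt? 1 boundary₁) _))
             (table-minDegree closure₁ (≤ᵇ⇒≤ 1 2 _) (decide-3×3 (goodAt? 1 closure₁) _))
             (tables-indistinguishable boundary₁ closure₁ (decide-3×3 (closedAt? boundary₁ closure₁) _))
             0<n 0<m (λ ()) (count-table-≤ boundary₁ _) (count-table-≤ closure₁ _)

  upper₂ : ∀ t → Diagnosable n m 2 t → t ≤ 7
  upper₂ = not-diagnosable (fromTable boundary₂) (fromTable closure₂)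
             (table-minDegree boundary₂ ≤-refl (decide-3×3 (goodAt? 2 boundary₂) _))
             (table-minDegree closure₂ ≤-refl (decide-3×3 (goodAt? 2 closure₂) _))
             (tables-indistinguishable boundary₂ closure₂ (decide-3×3 (closedAt? boundary₂ closure₂) _))
             0<n 0<m (λ ()) (count-table-≤ boundary₂ _) (count-table-≤ closure₂ _)

corollary6p1 : (n m : ℕ) → 5 ≤ m → m ≤ n →
    GoodNeighborDiagnosability n m 0 2 × GoodNeighborDiagnosability n m 1 4
      × GoodNeighborDiagnosability n m 2 7
corollary6p1 n m 5≤m m≤n =
  (diagnosable (forces₀ 5≤n 5≤m) , upper₀) ,
  (diagnosable (forces₁ 5≤n 5≤m) , upper₁) ,
  (diagnosable (forces₂ 5≤n 5≤m) , upper₂)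
  where
  5≤n : 5 ≤ n
  5≤n = ≤-trans 5≤m m≤n
  open Grid n m
  open Lift n m
  open Witnesses n m 5≤n 5≤m
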